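{- Let $\mathcal{R}$ be a completely defined TRS over $\mathcal{F}$ compatible with $>_{\mathsf{epo}^*}$, and let $s\in\mathcal{T}_{\mathsf{n}}$. If $s\to_{\mathsf{i}} t$ (innermost rewrite step of $\mathcal{R}$), then $t\in\mathcal{T}_{\mathsf{n}}$.
   Context: $\mathcal{F}=\mathcal{D}\uplus\mathcal{C}$ (defined symbols, constructors), $\succsim$ an admissible quasi-precedence (preorder with well-founded strict part $\succ$, equivalence $\sim$, and $f\succ c$ for all $f\in\mathcal{D}$, $c\in\mathcal{C}$), $\mathsf{safe}$ a safe mapping (each $n$-ary $f$ gets $\mathsf{safe}(f)\subseteq\{1,\dots,n\}$, others normal; all positions of constructors safe). Write $f(s_1,\dots,s_l;s_{l+1},\dots,s_{l+m})$ with normal arguments first (position order), then safe ones. $s\approx_s t$ iff $s=t$ or $s=f(s_1,\dots,s_l;s_{l+1},\dots,s_{l+m})$, $t=g(t_1,\dots,t_l;t_{l+1},\dots,t_{l+m})$, $f\sim g$, $s_i\approx_s t_i$ for all $i$. $f(s_1,\dots,s_n)\rhd_* t$ iff $s_i\rhd_* t$ or $s_i\approx_s t$ for some position $i$, normal if $f\in\mathcal{D}$. $>_{\mathsf{epo}^*}$ is the least relation such that for $s=f(s_1,\dots,s_l;s_{l+1},\dots,s_{l+m})$, $s>_{\mathsf{epo}^*}t$ if (1) $s_i\geq_{\mathsf{epo}^*}t$ for some $i$; or (2) $t=g(t_1,\dots,t_k;t_{k+1},\dots,t_{k+n})$, $f\succ g$, $s\rhd_* t_j$ ($j\le k$), $s>_{\mathsf{epo}^*}t_j$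 ($j>k$); or (3) $t$ as in (2), $f\sim g$, and for some $i\le\min(l,k)$: $s_j\approx_s t_j$ ($j<i$), $s_i\rhd_* t_i$, $s\rhd_* t_j$ ($i<j\le k$), $s>_{\mathsf{epo}^*}t_j$ ($j>k$); ${\geq_{\mathsf{epo}^*}}={>_{\mathsf{epo}^*}}\cup{\approx_s}$. Compatible: $l>_{\mathsf{epo}^*}r$ for every rule. A TRS is completely defined if no defined symbol occurs in any of its normal forms. $\to_{\mathsf{i}}$ rewrites a redex $l\sigma$ all of whose proper subterms are normal forms. $\mathcal{T}_{\mathsf{n}}$ is the least set of terms such that $\mathcal{T}(\mathcal{C},\mathcal{V})\subseteq\mathcal{T}_{\mathsf{n}}$, and $f(s_1,\dots,s_l;t_1,\dots,t_m)\in\mathcal{T}_{\mathsf{n}}$ whenever $f\in\mathcal{F}$, all normal arguments $s_i\in\mathcal{T}(\mathcal{C},\mathcal{V})$ and all safe arguments $t_j\in\mathcal{T}_{\mathsf{n}}$. -}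

module Defs where

open import Data.Nat using (ℕ; zero; suc)
open import Data.Fin using (Fin; zero; suc)
open import Data.Vec using (Vec; []; _∷_; lookup; _[_]≔_)
open import Data.List using (List; []; _∷_)
open import Data.List.Relation.Unary.All using (All)
import Data.Vec.Relation.Unary.All as VecAll
open import Data.List.Membership.Propositional using (_∈_)
open import Data.Bool using (Bool; true; false; if_then_else_; not)
open import Data.Product using (_×_; _,_)
open import Function using (_∘_)
open import Relation.Binary.PropositionalEquality using (_≡_)
open import Relation.Nullary using (¬_)
open import Relation.Binary.Structures using (IsPreorder)
open import Induction.WellFounded using (WellFounded)

-- Signature F = D ⊎ C given by a set of symbols Sym with arities ar;
-- defined f ≡ true means f ∈ D, defined f ≡ false means f ∈ C.
-- V is the set of variables.
module Framework (Sym : Set) (ar : Sym → ℕ) (defined : Sym → Bool) (V : Set) where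

  data Term : Set where
    var : V → Term
    app : (f : Sym) → Vec Term (ar f) → Term

  Defined : Sym → Set
  Defined f = defined f ≡ true

  Constructor : Sym → Set
  Constructor f = defined f ≡ false

  Subst : Set
  Subst = V → Term

  mutual
    _·_ : Term → Subst → Term
    var x · σ = σ x
    app f ts · σ = app f (substs ts σ)

    substs : ∀ {n} → Vec Term n → Subst → Vec Term n
    substs [] σ = []
    substs (t ∷ ts) σ = (t · σ) ∷ substs ts σ

  data _⊲_ : Term → Term → Set where
    arg    : ∀ {f ts} (i : Fin (ar f)) → lookup ts i ⊲ app f ts
    deeper : ∀ {u f ts} (i : Fin (ar f)) → u ⊲ lookup ts i → u ⊲ app f ts

  data _occursIn_ (g : Sym) : Term → Set where
    here  : ∀ {ts} → g occursIn app g ts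
    under : ∀ {f ts} (i : Fin (ar f)) → g occursIn lookup ts i → g occursIn app f ts

  data ConstrTerm : Term → Set where
    var : ∀ x → ConstrTerm (var x)
    app : ∀ {c ts} → Constructor c → VecAll.All ConstrTerm ts → ConstrTerm (app c ts)

  TRS : Set
  TRS = List (Term × Term)

  module Rewriting (R : TRS) where

    data _⟶_ : Term → Term → Set where
      root : ∀ {l r} (σ : Subst) → (l , r) ∈ R → (l · σ) ⟶ (r · σ)
      cong : ∀ {f ts u} (i : Fin (ar f)) → lookup ts i ⟶ u → app f ts ⟶ app f (ts [ i ]≔ u)

    NF : Term → Set
    NF t = ∀ u → ¬ (t ⟶ u)

    data _⟶i_ : Term → Term → Set where
      root : ∀ {l r} (σ : Subst) → (l , r) ∈ R →
             (∀ u → u ⊲ (l · σ) → NF u) → (l · σ) ⟶i (r · σ)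
      cong : ∀ {f ts u} (i : Fin (ar f)) → lookup ts i ⟶i u → app f ts ⟶i app f (ts [ i ]≔ u)

  CompletelyDefined : TRS → Set
  CompletelyDefined R = ∀ t → Rewriting.NF R t → ∀ f → f occursIn t → ¬ Defined f

  module Order (_≿_ : Sym → Sym → Set) (safe : (f : Sym) → Fin (ar f) → Bool) where

    _≻_ : Sym → Sym → Set
    f ≻ g = f ≿ g × ¬ (g ≿ f)

    _∼_ : Sym → Sym → Set
    f ∼ g = f ≿ g × g ≿ f

    AdmissibleQuasiPrecedence : Set
    AdmissibleQuasiPrecedence =
      IsPreorder _≡_ _≿_ ×
      WellFounded (λ g f → f ≻ g) ×
      (∀ f c → Defined f → Constructor c → f ≻ c)

    SafeMapping : Set
    SafeMapping = ∀ c → Constructor c → ∀ (i : Fin (ar c)) → safe c i ≡ true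

    select : ∀ {n} → (Fin n → Bool) → Vec Term n → List Term
    select p [] = []
    select p (x ∷ xs) = if p zero then x ∷ select (p ∘ suc) xs else select (p ∘ suc) xs

    normArgs : (f : Sym) → Vec Term (ar f) → List Term
    normArgs f ts = select (not ∘ safe f) ts

    safeArgs : (f : Sym) → Vec Term (ar f) → List Term
    safeArgs f ts = select (safe f) ts

    mutual
      data _≈s_ : Term → Term → Set where
        ≈refl : ∀ {s} → s ≈s s
        ≈app  : ∀ {f g ss ts} → f ∼ g →
                Pw (normArgs f ss) (normArgs g ts) →
                Pw (safeArgs f ss) (safeArgs g ts) →
                app f ss ≈s app g ts

      data Pw : List Term → List Term → Set where
        []  : Pw [] []
        _∷_ : ∀ {s t ss ts} → s ≈s t → Pw ss ts → Pw (s ∷ ss) (t ∷ ts)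

    data _▷*_ : Term → Term → Set where
      sub▷ : ∀ {f ts t} (i : Fin (ar f)) → (Defined f → safe f i ≡ false) →
             lookup ts i ▷* t → app f ts ▷* t
      sub≈ : ∀ {f ts t} (i : Fin (ar f)) → (Defined f → safe f i ≡ false) →
             lookup ts i ≈s t → app f ts ▷* t

    -- lexicographic part of clause (3), on normal arguments:
    -- some i ≤ min(l,k) with s_j ≈s t_j (j < i), s_i ▷* t_i, s ▷* t_j (i < j ≤ k)
    data Lex (s : Term) : List Term → List Term → Set where
      here  : ∀ {si ti ss tt} → si ▷* ti → All (s ▷*_) tt → Lex s (si ∷ ss) (ti ∷ tt)
      there : ∀ {si ti ss tt} → si ≈s ti → Lex s ss tt → Lex s (si ∷ ss) (ti ∷ tt)

    data _>epo_ : Term → Term → Set where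
      epo1> : ∀ {f ss t} (i : Fin (ar f)) → lookup ss i >epo t → app f ss >epo t
      epo1≈ : ∀ {f ss t} (i : Fin (ar f)) → lookup ss i ≈s t → app f ss >epo t
      epo2  : ∀ {f ss g ts} → f ≻ g →
              All (app f ss ▷*_) (normArgs g ts) →
              All (app f ss >epo_) (safeArgs g ts) →
              app f ss >epo app g ts
      epo3  : ∀ {f ss g ts} → f ∼ g →
              Lex (app f ss) (normArgs f ss) (normArgs g ts) →
              All (app f ss >epo_) (safeArgs g ts) →
              app f ss >epo app g ts

    Compatible : TRS → Set
    Compatible R = ∀ {l r} → (l , r) ∈ R → l >epo r

    data Tn : Term → Set where
      con : ∀ {t} → ConstrTerm t → Tn t
      app : ∀ {f ss} → All ConstrTerm (normArgs f ss) → All Tn (safeArgs f ss) → Tn (app f ss)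

module Submission where

open import Defs
open import Data.Nat using (ℕ)
open import Data.Fin using (Fin; zero; suc)
open import Data.Bool using (Bool; true; false; not)
open import Data.Bool.Properties using (¬-not)
open import Data.Vec using (Vec; []; _∷_; lookup; _[_]≔_)
open import Data.List.Relation.Unary.All using (All; []; _∷_)
import Data.Vec.Relation.Unary.All as VecAll
open import Data.Vec.Relation.Unary.All.Properties using (lookup⁺; lookup⁻)
open import Data.Product using (_,_; proj₁; proj₂)
open import Function using (_∘_)
open import Relation.Binary.PropositionalEquality using (_≡_; refl; subst; sym)
open import Relation.Nullary using (¬_)

-- The arguments of an innermost redex lσ are normal forms, hence constructor terms by complete
-- definedness.  Constructor instances are closed under ≈s, ▷* and >epo*: constructors are
-- minimal in the precedence and all their positions are safe.  Reading a derivation of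
-- l >epo* r top-down, a subterm of r reached by clause (1) is below an argument of lσ, a normal
-- argument reached through ▷* or the lexicographic comparison is too, and a safe argument is
-- again compared by >epo*, so rσ ∈ Tn.  A step below the root replaces a constructor term by a
-- constructor term, or a term of Tn in a safe position by a term of Tn.

[]≔-pointwise : ∀ {A : Set} {n} (P : Fin n → A → Set) (xs : Vec A n) i {y} →
                (∀ j → P j (lookup xs j)) → P i y → ∀ j → P j (lookup (xs [ i ]≔ y) j)
[]≔-pointwise P (x ∷ xs) zero    pxs py zero    = py
[]≔-pointwise P (x ∷ xs) zero    pxs py (suc j) = pxs (suc j)
[]≔-pointwise P (x ∷ xs) (suc i) pxs py zero    = pxs zero
[]≔-pointwise P (x ∷ xs) (suc i) pxs py (suc j) =
  []≔-pointwise (P ∘ suc) xs i (pxs ∘ suc) py j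

module _ (Sym : Set) (ar : Sym → ℕ) (defined : Sym → Bool) (V : Set) where
  open Framework Sym ar defined V

  lookup-substs : ∀ {n} (ts : Vec Term n) σ i → lookup (substs ts σ) i ≡ lookup ts i · σ
  lookup-substs (t ∷ ts) σ zero    = refl
  lookup-substs (t ∷ ts) σ (suc i) = lookup-substs ts σ i

  mutual
    noDefined⇒ConstrTerm : ∀ t → (∀ g → g occursIn t → ¬ Defined g) → ConstrTerm t
    noDefined⇒ConstrTerm (var x)    _  = var x
    noDefined⇒ConstrTerm (app g ts) nd =
      app (¬-not (nd g here)) (noDefined⇒ConstrTerms ts (λ i g o → nd g (under i o)))

    noDefined⇒ConstrTerms : ∀ {n} (ts : Vec Term n) →
                            (∀ i g → g occursIn lookup ts i → ¬ Defined g) →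
                            VecAll.All ConstrTerm ts
    noDefined⇒ConstrTerms []   _  = VecAll.[]
    noDefined⇒ConstrTerms (t ∷ ts) nd =
      noDefined⇒ConstrTerm t (nd zero) VecAll.∷ noDefined⇒ConstrTerms ts (nd ∘ suc)

  module _ (σ : Subst) where

    ConstrInstance : Term → Set
    ConstrInstance t = ConstrTerm (t · σ)

    ConstrArgs : ∀ {n} → Vec Term n → Set
    ConstrArgs ts = ∀ i → ConstrInstance (lookup ts i)

    ConstrInstance-head : ∀ {f ts} → ConstrInstance (app f ts) → Constructor f
    ConstrInstance-head (app cf _) = cf

    ConstrInstance-args : ∀ {f} ts → ConstrInstance (app f ts) → ConstrArgs ts
    ConstrInstance-args ts (app _ cs) i = subst ConstrTerm (lookup-substs ts σ i) (lookup⁺ cs i)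

  module _ (_≿_ : Sym → Sym → Set) (safe : (f : Sym) → Fin (ar f) → Bool) where
    open Order _≿_ safe

    All-select⁻ : ∀ {n} {P : Term → Set} (p : Fin n → Bool) (xs : Vec Term n) →
                  All P (select p xs) → ∀ i → p i ≡ true → P (lookup xs i)
    All-select⁻ p (x ∷ xs) pxs zero pi with p zero
    All-select⁻ p (x ∷ xs) (px ∷ _) zero _  | true = px
    All-select⁻ p (x ∷ xs) pxs      zero () | false
    All-select⁻ p (x ∷ xs) pxs (suc i) pi with p zero
    All-select⁻ p (x ∷ xs) (_ ∷ pxs) (suc i) pi | true  = All-select⁻ (p ∘ suc) xs pxs i pi
    All-select⁻ p (x ∷ xs) pxs       (suc i) pi | false = All-select⁻ (p ∘ suc) xs pxs i pi

    All-select⁺ : ∀ {n} {P : Term → Set} (p : Fin n → Bool) (xs : Vec Term n) →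
                  (∀ i → p i ≡ true → P (lookup xs i)) → All P (select p xs)
    All-select⁺ p [] _ = []
    All-select⁺ p (x ∷ xs) pxs with p zero in p0
    ... | true  = pxs zero p0 ∷ All-select⁺ (p ∘ suc) xs (pxs ∘ suc)
    ... | false = All-select⁺ (p ∘ suc) xs (pxs ∘ suc)

    All-select-[]≔ : ∀ {n} {P : Term → Set} (p : Fin n → Bool) (xs : Vec Term n) i {y} →
                     (p i ≡ true → P (lookup xs i) → P y) →
                     All P (select p xs) → All P (select p (xs [ i ]≔ y))
    All-select-[]≔ {P = P} p xs i step pxs = All-select⁺ p (xs [ i ]≔ _)
      ([]≔-pointwise (λ j x → p j ≡ true → P x) xs i
        (All-select⁻ p xs pxs) (λ pi → step pi (All-select⁻ p xs pxs i pi)))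

    All-select-substs : ∀ {n} {P : Term → Set} (p : Fin n → Bool) (xs : Vec Term n) σ →
                        All (λ x → P (x · σ)) (select p xs) → All P (select p (substs xs σ))
    All-select-substs {P = P} p xs σ pxs = All-select⁺ p (substs xs σ)
      (λ i pi → subst P (sym (lookup-substs xs σ i)) (All-select⁻ p xs pxs i pi))

    module _ (defined≻constructor : ∀ f c → Defined f → Constructor c → f ≻ c)
             (safeMapping : SafeMapping) where

      ≿-constructor : ∀ {f g} → Constructor f → f ≿ g → Constructor g
      ≿-constructor {f} {g} cf f≿g =
        ¬-not (λ dg → proj₂ (defined≻constructor g f dg cf) f≿g)

      safeArgs-constructor : ∀ {c} {P : Term → Set} (ts : Vec Term (ar c)) → Constructor c →
                             All P (safeArgs c ts) → VecAll.All P ts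
      safeArgs-constructor {c} ts cc pts =
        lookup⁻ (λ i → All-select⁻ (safe c) ts pts i (safeMapping c cc i))

      module _ (σ : Subst) where

        ConstrInstance-app : ∀ {f g ss} (ts : Vec Term (ar g)) →
                             ConstrInstance σ (app f ss) → f ≿ g →
                             All (ConstrInstance σ) (safeArgs g ts) →
                             ConstrInstance σ (app g ts)
        ConstrInstance-app {g = g} ts c f≿g cts =
          app cg (safeArgs-constructor (substs ts σ) cg (All-select-substs (safe g) ts σ cts))
          where cg = ≿-constructor (ConstrInstance-head σ c) f≿g

        mutual
          ≈s-constr : ∀ {s t} → ConstrInstance σ s → s ≈s t → ConstrInstance σ t
          ≈s-constr c ≈refl = c
          ≈s-constr {app f ss} {app g ts} c (≈app f∼g _ safe≈) =
            ConstrInstance-app ts c (proj₁ f∼g) (Pw-constr safe-constr safe≈)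
            where
              safe-constr : All (ConstrInstance σ) (safeArgs f ss)
              safe-constr = All-select⁺ (safe f) ss (λ i _ → ConstrInstance-args σ ss c i)

          Pw-constr : ∀ {ss ts} → All (ConstrInstance σ) ss → Pw ss ts →
                      All (ConstrInstance σ) ts
          Pw-constr []       []       = []
          Pw-constr (c ∷ cs) (e ∷ es) = ≈s-constr c e ∷ Pw-constr cs es

        mutual
          >epo-constr : ∀ {s t} → ConstrInstance σ s → s >epo t → ConstrInstance σ t
          >epo-constr {app f ss} c (epo1> i p) = >epo-constr (ConstrInstance-args σ ss c i) p
          >epo-constr {app f ss} c (epo1≈ i e) = ≈s-constr (ConstrInstance-args σ ss c i) e
          >epo-constr {t = app g ts} c (epo2 f≻g _ safe>) =
            ConstrInstance-app ts c (proj₁ f≻g) (All->epo-constr c safe>)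
          >epo-constr {t = app g ts} c (epo3 f∼g _ safe>) =
            ConstrInstance-app ts c (proj₁ f∼g) (All->epo-constr c safe>)

          All->epo-constr : ∀ {s ts} → ConstrInstance σ s → All (s >epo_) ts →
                            All (ConstrInstance σ) ts
          All->epo-constr c []       = []
          All->epo-constr c (p ∷ ps) = >epo-constr c p ∷ All->epo-constr c ps

        mutual
          ▷*-constr : ∀ {s t} → ConstrInstance σ s → s ▷* t → ConstrInstance σ t
          ▷*-constr {app f ss} c p = ▷*-constrArgs (ConstrInstance-args σ ss c) p

          ▷*-constrArgs : ∀ {f ss t} → ConstrArgs σ ss → app f ss ▷* t → ConstrInstance σ t
          ▷*-constrArgs cs (sub▷ i _ p) = ▷*-constr (cs i) p
          ▷*-constrArgs cs (sub≈ i _ e) = ≈s-constr (cs i) e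

        module _ {f} {ls : Vec Term (ar f)} (cls : ConstrArgs σ ls) where

          All-▷*-constr : ∀ {ts} → All (app f ls ▷*_) ts → All (ConstrInstance σ) ts
          All-▷*-constr []       = []
          All-▷*-constr (p ∷ ps) = ▷*-constrArgs cls p ∷ All-▷*-constr ps

          Lex-constr : ∀ {ss ts} → All (ConstrInstance σ) ss → Lex (app f ls) ss ts →
                       All (ConstrInstance σ) ts
          Lex-constr (c ∷ _)  (here p ps)  = ▷*-constr c p ∷ All-▷*-constr ps
          Lex-constr (c ∷ cs) (there e lx) = ≈s-constr c e ∷ Lex-constr cs lx

          mutual
            >epo-Tn : ∀ {t} → app f ls >epo t → Tn (t · σ)
            >epo-Tn (epo1> i p) = con (>epo-constr (cls i) p)
            >epo-Tn (epo1≈ i e) = con (≈s-constr (cls i) e)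
            >epo-Tn {app g ts} (epo2 _ norm▷ safe>) =
              app (All-select-substs _ ts σ (All-▷*-constr norm▷))
                  (All-select-substs _ ts σ (All->epo-Tn safe>))
            >epo-Tn {app g ts} (epo3 _ lex safe>) =
              app (All-select-substs _ ts σ (Lex-constr (All-select⁺ _ ls λ i _ → cls i) lex))
                  (All-select-substs _ ts σ (All->epo-Tn safe>))

            All->epo-Tn : ∀ {ts} → All (app f ls >epo_) ts → All (λ t → Tn (t · σ)) ts
            All->epo-Tn []       = []
            All->epo-Tn (p ∷ ps) = >epo-Tn p ∷ All->epo-Tn ps

      module _ (R : TRS) (compatible : Compatible R) where
        open Rewriting R

        ⟶i-constr : ∀ {s t} → ConstrTerm s → s ⟶i t → ConstrTerm t
        ⟶i-constr c (root σ l→r _) = >epo-constr σ c (compatible l→r)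
        ⟶i-constr (app cf cs) (cong {ts = ts} i st) =
          app cf (lookup⁻ ([]≔-pointwise (λ _ → ConstrTerm) ts i
                             (lookup⁺ cs) (⟶i-constr (lookup⁺ cs i) st)))

        module _ (completelyDefined : CompletelyDefined R) where

          innermost-redex-constrArgs : ∀ {f} (ls : Vec Term (ar f)) σ →
                                       (∀ u → u ⊲ (app f ls · σ) → NF u) →
                                       ConstrArgs σ ls
          innermost-redex-constrArgs ls σ nf i = subst ConstrTerm (lookup-substs ls σ i)
            (noDefined⇒ConstrTerm _ (completelyDefined _ (nf _ (arg i))))

          ⟶i-Tn : ∀ {s t} → Tn s → s ⟶i t → Tn t
          ⟶i-Tn _ (root {var x} σ l→r _) with compatible l→r
          ... | ()
          ⟶i-Tn _ (root {app f ls} σ l→r nf) =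
            >epo-Tn σ (innermost-redex-constrArgs ls σ nf) (compatible l→r)
          ⟶i-Tn (con c) st = con (⟶i-constr c st)
          ⟶i-Tn (app normConstr safeTn) (cong {f} {ts} i st) =
            app (All-select-[]≔ (not ∘ safe f) ts i (λ _ c → ⟶i-constr c st) normConstr)
                (All-select-[]≔ (safe f) ts i (λ _ tn → ⟶i-Tn tn st) safeTn)

lemma4 : (Sym : Set) (ar : Sym → ℕ) (defined : Sym → Bool) (V : Set)
    (_≿_ : Sym → Sym → Set) (safe : (f : Sym) → Fin (ar f) → Bool) →
    let open Framework Sym ar defined V in
    let open Order _≿_ safe in
    AdmissibleQuasiPrecedence → SafeMapping →
    (R : TRS) → CompletelyDefined R → Compatible R →
    ∀ s t → Tn s → Rewriting._⟶i_ R s t → Tn t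
lemma4 Sym ar defined V _≿_ safe (_ , _ , defined≻constructor) safeMapping R
       completelyDefined compatible s t =
  ⟶i-Tn Sym ar defined V _≿_ safe defined≻constructor safeMapping
        R compatible completelyDefined
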